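{- (i) Let $\mathbf S=(S,\leq,*,1)$ be a skew Hilbert algebra with bottom element $0$, put $x':=x*0$, $S':=\{x'\mid x\in S\}$ and $\mathbb O(\mathbf S):=(S',\leq,{}',0,1)$ (order and $'$ restricted to $S'$). Then (a) $\mathbb O(\mathbf S)$ is an orthoposet; (b) $\mathbb S(\mathbb O(\mathbf S))=\mathbf S$ if and only if $S'=S$ and $x*y=y$ for all $x,y\in S$ with $x\not\leq y\neq 0$. (ii) Let $\mathbf P=(P,\leq,{}',0,1)$ be an orthoposet. Then (c) $\mathbb S(\mathbf P)$ is a skew Hilbert algebra with bottom element $0$ satisfying $\{x*0\mid x\in P\}=P$ and $x*y=y$ for all $x,y\in P$ with $x\not\leq y\neq 0$ (and it is strong); (d) $\mathbb O(\mathbb S(\mathbf P))=\mathbf P$.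
   Context: For a bounded poset $\mathbf Q=(Q,\leq,{}',0,1)$ with a unary operation $'$, $\mathbb S(\mathbf Q)=(Q,\leq,\circ,1)$ where $x\circ y:=1$ if $x\leq y$, $x\circ y:=x'$ if $x\not\leq y$ and $y=0$, and $x\circ y:=y$ otherwise. For a poset and subset $A$, $L(A)$, $U(A)$ are the sets of lower and upper bounds; $L(U(x,y),z)=L(U(\{x,y\})\cup\{z\})$. A skew Hilbert algebra is a poset $(S,\leq,*,1)$ with binary operation $*$ and constant $1$ such that for all $x,y,z$: (S1) $x\leq y$ iff $x*y=1$; (S2) if $y*x=1$ then $x*((x*y)*y)=1$; (S3) if $x*y=1$ then $(y*z)*(x*z)=1$; (S4) $L(U(x,y),x*y)=L(y)$; it is strong if $x*((x*y)*y)=1$ for all $x,y$. An orthoposet is a bounded poset $(P,\leq,{}',0,1)$ with an antitone involution $'$ (i.e. $x\leq y\Rightarrow y'\leq x'$ and $x''=x$) that is a complementation: $L(x,x')=\{0\}$ and $U(x,x')=\{1\}$ for all $x$. -}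

module Defs where

open import Level using (0ℓ)
open import Data.Product using (Σ; ∃; _×_; _,_)
open import Data.Unit using (⊤)
open import Relation.Nullary using (¬_; Dec; yes; no)
open import Relation.Binary.PropositionalEquality using (_≡_; _≢_)
open import Relation.Binary.Structures using (IsPartialOrder)
open import Relation.Unary using (Pred; _∪_; _≐_; ｛_｝)
open import Axiom.ExcludedMiddle using (ExcludedMiddle)

module _ {A : Set} (_≤_ : A → A → Set) where

  pair : A → A → Pred A 0ℓ
  pair x y z = (z ≡ x) Data.Sum.⊎ (z ≡ y)
    where import Data.Sum

  Lb : Pred A 0ℓ → Pred A 0ℓ
  Lb B z = ∀ w → B w → z ≤ w

  Ub : Pred A 0ℓ → Pred A 0ℓ
  Ub B z = ∀ w → B w → w ≤ z

  LbIn : Pred A 0ℓ → Pred A 0ℓ → Pred A 0ℓ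
  LbIn P B z = P z × Lb B z

  UbIn : Pred A 0ℓ → Pred A 0ℓ → Pred A 0ℓ
  UbIn P B z = P z × Ub B z

  record IsSkewHilbert (_*_ : A → A → A) (𝟏 : A) : Set where
    field
      isPartialOrder : IsPartialOrder _≡_ _≤_
      S1 : ∀ x y → (x ≤ y → x * y ≡ 𝟏) × (x * y ≡ 𝟏 → x ≤ y)
      S2 : ∀ x y → y * x ≡ 𝟏 → x * ((x * y) * y) ≡ 𝟏
      S3 : ∀ x y z → x * y ≡ 𝟏 → (y * z) * (x * z) ≡ 𝟏
      S4 : ∀ x y → Lb (Ub (pair x y) ∪ ｛ x * y ｝) ≐ Lb ｛ y ｝

  IsStrong : (_*_ : A → A → A) (𝟏 : A) → Set
  IsStrong _*_ 𝟏 = ∀ x y → x * ((x * y) * y) ≡ 𝟏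

  -- (P, ≤ restricted to P, ′, 0, 1) is an orthoposet, where P ⊆ A.
  -- With P = everything this is the usual notion of an orthoposet on A.
  record IsOrthoposetOn (P : Pred A 0ℓ) (_′ : A → A) (𝟎 𝟏 : A) : Set where
    field
      refl    : ∀ x → P x → x ≤ x
      antisym : ∀ x y → P x → P y → x ≤ y → y ≤ x → x ≡ y
      trans   : ∀ x y z → P x → P y → P z → x ≤ y → y ≤ z → x ≤ z
      𝟎∈      : P 𝟎
      𝟏∈      : P 𝟏
      ′-closed : ∀ x → P x → P (x ′)
      bottom  : ∀ x → P x → 𝟎 ≤ x
      top     : ∀ x → P x → x ≤ 𝟏
      antitone : ∀ x y → P x → P y → x ≤ y → (y ′) ≤ (x ′)
      involutive : ∀ x → P x → (x ′) ′ ≡ x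
      complL : ∀ x → P x → LbIn P (pair x (x ′)) ≐ ｛ 𝟎 ｝
      complU : ∀ x → P x → UbIn P (pair x (x ′)) ≐ ｛ 𝟏 ｝

  IsOrthoposet : (_′ : A → A) (𝟎 𝟏 : A) → Set
  IsOrthoposet = IsOrthoposetOn (λ _ → ⊤)

  Sop : ExcludedMiddle 0ℓ → (_′ : A → A) (𝟎 𝟏 : A) → A → A → A
  Sop lem _′ 𝟎 𝟏 x y with lem {x ≤ y}
  ... | yes _ = 𝟏
  ... | no _ with lem {y ≡ 𝟎}
  ...   | yes _ = x ′
  ...   | no _ = y

Image0 : {A : Set} → (A → A → A) → A → Pred A 0ℓ
Image0 _*_ 𝟎 z = ∃ λ x → z ≡ x * 𝟎

-- In a skew Hilbert algebra with bottom, S4 says that z ≤ x and z ≤ x * y force z ≤ y,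
-- a form of modus ponens.  Taking y = 0 shows that x and x′ = x * 0 have no common lower
-- bound except 0; together with the antitonicity of ′ (S3) and x ≤ x′′ (S2), this makes
-- ′ an involutive complementation on S′.  Conversely, in an orthoposet the operation ∘ of
-- 𝕊(P) is 1, y or x′ according to three exclusive cases, and each axiom of a (strong) skew
-- Hilbert algebra is checked case by case, the only nontrivial ingredient being that x and
-- x′ have no nonzero common lower bound.
module Submission where

open import Defs
open import Level using (0ℓ)
open import Data.Product using (_×_; _,_; proj₁; proj₂)
open import Data.Sum using (inj₁; inj₂)
open import Data.Unit using (tt)
open import Data.Empty using (⊥-elim)
open import Relation.Nullary using (¬_; yes; no)
open import Relation.Unary using (Pred; _∪_; ｛_｝; _≐_)
open import Relation.Binary.Structures using (IsPartialOrder)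
open import Relation.Binary.PropositionalEquality
  using (_≡_; _≢_; refl; sym; trans; cong; subst; subst₂; isEquivalence)
open import Axiom.ExcludedMiddle using (ExcludedMiddle)

module SopCases (lem : ExcludedMiddle 0ℓ) {A : Set} (_≤_ : A → A → Set) (_′ : A → A) (𝟎 𝟏 : A) where

  infix 25 _∘_
  _∘_ : A → A → A
  _∘_ = Sop _≤_ lem _′ 𝟎 𝟏

  data SopCase (x y x∘y : A) : Set where
    ≤-case   : x ≤ y → x∘y ≡ 𝟏 → SopCase x y x∘y
    ≰𝟎-case  : ¬ (x ≤ y) → y ≡ 𝟎 → x∘y ≡ x ′ → SopCase x y x∘y
    ≰≢𝟎-case : ¬ (x ≤ y) → y ≢ 𝟎 → x∘y ≡ y → SopCase x y x∘y

  sopCase : ∀ x y → SopCase x y (Sop _≤_ lem _′ 𝟎 𝟏 x y)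
  sopCase x y with lem {x ≤ y}
  ... | yes x≤y = ≤-case x≤y refl
  ... | no x≰y with lem {y ≡ 𝟎}
  ...   | yes y≡𝟎 = ≰𝟎-case x≰y y≡𝟎 refl
  ...   | no y≢𝟎 = ≰≢𝟎-case x≰y y≢𝟎 refl

  ∘-≤ : ∀ {x y} → x ≤ y → x ∘ y ≡ 𝟏
  ∘-≤ {x} {y} x≤y with sopCase x y
  ... | ≤-case _ eq = eq
  ... | ≰𝟎-case x≰y _ _ = ⊥-elim (x≰y x≤y)
  ... | ≰≢𝟎-case x≰y _ _ = ⊥-elim (x≰y x≤y)

  ∘-≰≢𝟎 : ∀ {x y} → ¬ (x ≤ y) → y ≢ 𝟎 → x ∘ y ≡ y
  ∘-≰≢𝟎 {x} {y} x≰y y≢𝟎 with sopCase x y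
  ... | ≤-case x≤y _ = ⊥-elim (x≰y x≤y)
  ... | ≰𝟎-case _ y≡𝟎 _ = ⊥-elim (y≢𝟎 y≡𝟎)
  ... | ≰≢𝟎-case _ _ eq = eq

module SkewHilbertProperties {A : Set} {_≤_ : A → A → Set} {_*_ : A → A → A} {𝟏 : A}
  (H : IsSkewHilbert _≤_ _*_ 𝟏) where

  open IsSkewHilbert H
  open IsPartialOrder isPartialOrder using (antisym) renaming (refl to ≤-refl; trans to ≤-trans)

  y≤x*y : ∀ x y → y ≤ (x * y)
  y≤x*y x y = proj₂ (S4 x y) (λ { _ refl → ≤-refl }) (x * y) (inj₂ refl)

  x≤𝟏 : ∀ x → x ≤ 𝟏
  x≤𝟏 x = subst (x ≤_) (proj₁ (S1 x x) ≤-refl) (y≤x*y x x)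

  ≤-modusPonens : ∀ {x y z} → z ≤ x → z ≤ (x * y) → z ≤ y
  ≤-modusPonens {x} {y} {z} z≤x z≤x*y = proj₁ (S4 x y) lowerBound y refl
    where
    lowerBound : Lb _≤_ (Ub _≤_ (pair _≤_ x y) ∪ ｛ x * y ｝) z
    lowerBound w (inj₁ w-ub) = ≤-trans z≤x (w-ub x (inj₁ refl))
    lowerBound w (inj₂ refl) = z≤x*y

  𝟏*y≡y : ∀ y → 𝟏 * y ≡ y
  𝟏*y≡y y = antisym (≤-modusPonens (x≤𝟏 _) ≤-refl) (y≤x*y 𝟏 y)

  module WithBottom {𝟎 : A} (𝟎≤ : ∀ x → 𝟎 ≤ x) where

    infixl 30 _′
    _′ : A → A
    x ′ = x * 𝟎

    S′ : Pred A 0ℓ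
    S′ = Image0 _*_ 𝟎

    𝟎′≡𝟏 : 𝟎 ′ ≡ 𝟏
    𝟎′≡𝟏 = proj₁ (S1 𝟎 𝟎) ≤-refl

    x≤x′′ : ∀ x → x ≤ x ′ ′
    x≤x′′ x = proj₂ (S1 _ _) (S2 x 𝟎 (proj₁ (S1 𝟎 x) (𝟎≤ x)))

    ′-antitone : ∀ {x y} → x ≤ y → y ′ ≤ x ′
    ′-antitone {x} {y} x≤y = proj₂ (S1 _ _) (S3 x y 𝟎 (proj₁ (S1 x y) x≤y))

    S′-involutive : ∀ x → S′ x → x ′ ′ ≡ x
    S′-involutive _ (a , refl) = antisym (′-antitone (x≤x′′ a)) (x≤x′′ (a ′))

    ≤-complement⇒≡𝟎 : ∀ {x z} → z ≤ x → z ≤ x ′ → z ≡ 𝟎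
    ≤-complement⇒≡𝟎 z≤x z≤x′ = antisym (≤-modusPonens z≤x z≤x′) (𝟎≤ _)

    S′-complement≤⇒≡𝟏 : ∀ {x z} → S′ z → x ≤ z → x ′ ≤ z → z ≡ 𝟏
    S′-complement≤⇒≡𝟏 {x} {z} z∈S′ x≤z x′≤z = antisym (x≤𝟏 z) 𝟏≤z
      where
      z′≡𝟎 : z ′ ≡ 𝟎
      z′≡𝟎 = ≤-complement⇒≡𝟎 (≤-trans (′-antitone x≤z) x′≤z) ≤-refl

      𝟏≤z : 𝟏 ≤ z
      𝟏≤z = subst₂ _≤_ 𝟎′≡𝟏 (S′-involutive z z∈S′) (subst (λ u → u ′ ≤ z ′ ′) z′≡𝟎 ≤-refl)

    𝕆-isOrthoposet : IsOrthoposetOn _≤_ S′ _′ 𝟎 𝟏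
    𝕆-isOrthoposet = record
      { refl       = λ _ _ → ≤-refl
      ; antisym    = λ _ _ _ _ → antisym
      ; trans      = λ _ _ _ _ _ _ → ≤-trans
      ; 𝟎∈         = 𝟏 , sym (𝟏*y≡y 𝟎)
      ; 𝟏∈         = 𝟎 , sym 𝟎′≡𝟏
      ; ′-closed   = λ x _ → x , refl
      ; bottom     = λ x _ → 𝟎≤ x
      ; top        = λ x _ → x≤𝟏 x
      ; antitone   = λ _ _ _ _ → ′-antitone
      ; involutive = S′-involutive
      ; complL     = λ x _ →
          (λ { (_ , lb) → sym (≤-complement⇒≡𝟎 (lb x (inj₁ refl)) (lb (x ′) (inj₂ refl))) })
          , (λ { refl → (𝟏 , sym (𝟏*y≡y 𝟎)) , (λ w _ → 𝟎≤ w) })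
      ; complU     = λ x _ →
          (λ { (z∈S′ , ub) → sym (S′-complement≤⇒≡𝟏 z∈S′ (ub x (inj₁ refl)) (ub (x ′) (inj₂ refl))) })
          , (λ { refl → (𝟎 , sym 𝟎′≡𝟏) , (λ w _ → x≤𝟏 w) })
      }

    module _ (lem : ExcludedMiddle 0ℓ) where
      open SopCases lem _≤_ _′ 𝟎 𝟏

      𝕊𝕆-agrees : Set
      𝕊𝕆-agrees = ∀ x y → S′ x → S′ y → x ∘ y ≡ x * y

      *-≰≢𝟎 : Set
      *-≰≢𝟎 = ∀ x y → ¬ (x ≤ y) → y ≢ 𝟎 → x * y ≡ y

      𝕊𝕆-agrees⇒*-≰≢𝟎 : (∀ x → S′ x) → 𝕊𝕆-agrees → *-≰≢𝟎
      𝕊𝕆-agrees⇒*-≰≢𝟎 S′-total agrees x y x≰y y≢𝟎 =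
        trans (sym (agrees x y (S′-total x) (S′-total y))) (∘-≰≢𝟎 x≰y y≢𝟎)

      *-≰≢𝟎⇒𝕊𝕆-agrees : *-≰≢𝟎 → 𝕊𝕆-agrees
      *-≰≢𝟎⇒𝕊𝕆-agrees absorbs x y _ _ with sopCase x y
      ... | ≤-case x≤y eq = trans eq (sym (proj₁ (S1 x y) x≤y))
      ... | ≰𝟎-case _ refl eq = eq
      ... | ≰≢𝟎-case x≰y y≢𝟎 eq = trans eq (sym (absorbs x y x≰y y≢𝟎))

module OrthoposetProperties (lem : ExcludedMiddle 0ℓ) {P : Set} {_≤_ : P → P → Set} {_′ : P → P} {𝟎 𝟏 : P}
  (O : IsOrthoposet _≤_ _′ 𝟎 𝟏) where

  open SopCases lem _≤_ _′ 𝟎 𝟏 public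
  private module O = IsOrthoposetOn O

  ≤-refl : ∀ {x} → x ≤ x
  ≤-refl = O.refl _ tt

  ≤-trans : ∀ {x y z} → x ≤ y → y ≤ z → x ≤ z
  ≤-trans = O.trans _ _ _ tt tt tt

  ≤-antisym : ∀ {x y} → x ≤ y → y ≤ x → x ≡ y
  ≤-antisym = O.antisym _ _ tt tt

  𝟎≤ : ∀ x → 𝟎 ≤ x
  𝟎≤ x = O.bottom x tt

  x≤𝟏 : ∀ x → x ≤ 𝟏
  x≤𝟏 x = O.top x tt

  ′-involutive : ∀ x → x ′ ′ ≡ x
  ′-involutive x = O.involutive x tt

  ′-antitone : ∀ {x y} → x ≤ y → (y ′) ≤ (x ′)
  ′-antitone = O.antitone _ _ tt tt

  ≤-complement⇒≡𝟎 : ∀ {x z} → z ≤ x → z ≤ (x ′) → z ≡ 𝟎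
  ≤-complement⇒≡𝟎 {x} z≤x z≤x′ =
    sym (proj₁ (O.complL x tt) (tt , λ { _ (inj₁ refl) → z≤x ; _ (inj₂ refl) → z≤x′ }))

  𝟏′≡𝟎 : 𝟏 ′ ≡ 𝟎
  𝟏′≡𝟎 = ≤-complement⇒≡𝟎 (x≤𝟏 _) ≤-refl

  𝟎′≡𝟏 : 𝟎 ′ ≡ 𝟏
  𝟎′≡𝟏 = sym (proj₁ (O.complU 𝟎 tt) (tt , λ { _ (inj₁ refl) → 𝟎≤ _ ; _ (inj₂ refl) → ≤-refl }))

  x∘𝟎≡x′ : ∀ x → x ∘ 𝟎 ≡ x ′
  x∘𝟎≡x′ x with sopCase x 𝟎
  ... | ≤-case x≤𝟎 eq = trans eq (trans (sym 𝟎′≡𝟏) (cong _′ (≤-antisym (𝟎≤ x) x≤𝟎)))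
  ... | ≰𝟎-case _ _ eq = eq
  ... | ≰≢𝟎-case _ 𝟎≢𝟎 _ = ⊥-elim (𝟎≢𝟎 refl)

  ∘𝟎-surjective : ∀ z → Image0 _∘_ 𝟎 z
  ∘𝟎-surjective z = z ′ , sym (trans (x∘𝟎≡x′ (z ′)) (′-involutive z))

  ∘≡𝟏⇒≤ : ∀ {x y} → x ∘ y ≡ 𝟏 → x ≤ y
  ∘≡𝟏⇒≤ {x} {y} x∘y≡𝟏 with sopCase x y
  ... | ≤-case x≤y _ = x≤y
  ... | ≰𝟎-case x≰y refl eq = ⊥-elim (x≰y (subst (x ≤_) x≡𝟎 ≤-refl))
    where
    x≡𝟎 : x ≡ 𝟎
    x≡𝟎 = trans (sym (′-involutive x)) (trans (cong _′ (trans (sym eq) x∘y≡𝟏)) 𝟏′≡𝟎)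
  ... | ≰≢𝟎-case x≰y _ eq = ⊥-elim (x≰y (subst (x ≤_) (trans (sym x∘y≡𝟏) eq) (x≤𝟏 x)))

  x≤[x∘y]∘y : ∀ x y → x ≤ (x ∘ y) ∘ y
  x≤[x∘y]∘y x y with sopCase x y
  ... | ≰≢𝟎-case _ _ eq rewrite eq = subst (x ≤_) (sym (∘-≤ ≤-refl)) (x≤𝟏 x)
  ... | ≤-case x≤y eq rewrite eq with sopCase 𝟏 y
  ...   | ≤-case _ eq′ = subst (x ≤_) (sym eq′) (x≤𝟏 x)
  ...   | ≰𝟎-case _ refl eq′ = subst (x ≤_) (sym (trans eq′ 𝟏′≡𝟎)) x≤y
  ...   | ≰≢𝟎-case _ _ eq′ = subst (x ≤_) (sym eq′) x≤y
  x≤[x∘y]∘y x y | ≰𝟎-case _ refl eq rewrite eq with sopCase (x ′) 𝟎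
  ...   | ≤-case _ eq′ = subst (x ≤_) (sym eq′) (x≤𝟏 x)
  ...   | ≰𝟎-case _ _ eq′ = subst (x ≤_) (sym (trans eq′ (′-involutive x))) ≤-refl
  ...   | ≰≢𝟎-case _ 𝟎≢𝟎 _ = ⊥-elim (𝟎≢𝟎 refl)

  ∘-antitoneˡ : ∀ {x y} z → x ≤ y → y ∘ z ≤ x ∘ z
  ∘-antitoneˡ {x} {y} z x≤y with sopCase x z | sopCase y z
  ... | ≤-case _ eq | _ = subst (y ∘ z ≤_) (sym eq) (x≤𝟏 _)
  ... | ≰𝟎-case x≰z _ _ | ≤-case y≤z _ = ⊥-elim (x≰z (≤-trans x≤y y≤z))
  ... | ≰𝟎-case _ _ eq | ≰𝟎-case _ _ eq′ = subst₂ _≤_ (sym eq′) (sym eq) (′-antitone x≤y)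
  ... | ≰𝟎-case _ z≡𝟎 _ | ≰≢𝟎-case _ z≢𝟎 _ = ⊥-elim (z≢𝟎 z≡𝟎)
  ... | ≰≢𝟎-case x≰z _ _ | ≤-case y≤z _ = ⊥-elim (x≰z (≤-trans x≤y y≤z))
  ... | ≰≢𝟎-case _ z≢𝟎 _ | ≰𝟎-case _ z≡𝟎 _ = ⊥-elim (z≢𝟎 z≡𝟎)
  ... | ≰≢𝟎-case _ _ eq | ≰≢𝟎-case _ _ eq′ = subst₂ _≤_ (sym eq′) (sym eq) ≤-refl

  y≤x∘y : ∀ x y → y ≤ x ∘ y
  y≤x∘y x y with sopCase x y
  ... | ≤-case _ eq = subst (y ≤_) (sym eq) (x≤𝟏 y)
  ... | ≰𝟎-case _ refl _ = 𝟎≤ _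
  ... | ≰≢𝟎-case _ _ eq = subst (y ≤_) (sym eq) ≤-refl

  ∘-S4 : ∀ x y → Lb _≤_ (Ub _≤_ (pair _≤_ x y) ∪ ｛ x ∘ y ｝) ≐ Lb _≤_ ｛ y ｝
  ∘-S4 x y = (λ lb → λ { _ refl → below-y lb })
           , (λ { lb _ (inj₁ ub) → ≤-trans (lb y refl) (ub y (inj₂ refl))
                ; lb _ (inj₂ refl) → ≤-trans (lb y refl) (y≤x∘y x y) })
    where
    below-y : ∀ {z} → Lb _≤_ (Ub _≤_ (pair _≤_ x y) ∪ ｛ x ∘ y ｝) z → z ≤ y
    below-y lb with sopCase x y
    ... | ≤-case x≤y _ = lb y (inj₁ λ { _ (inj₁ refl) → x≤y ; _ (inj₂ refl) → ≤-refl })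
    ... | ≰𝟎-case _ refl eq = subst (_ ≤_) z≡𝟎 ≤-refl
      where
      z≤x = lb x (inj₁ λ { _ (inj₁ refl) → ≤-refl ; _ (inj₂ refl) → 𝟎≤ x })
      z≡𝟎 = ≤-complement⇒≡𝟎 z≤x (subst (_ ≤_) eq (lb (x ∘ 𝟎) (inj₂ refl)))
    ... | ≰≢𝟎-case _ _ eq = subst (_ ≤_) eq (lb (x ∘ y) (inj₂ refl))

  isPartialOrder : IsPartialOrder _≡_ _≤_
  isPartialOrder = record
    { isPreorder = record
      { isEquivalence = isEquivalence
      ; reflexive     = λ { refl → ≤-refl }
      ; trans         = ≤-trans
      }
    ; antisym = ≤-antisym
    }

  𝕊-isSkewHilbert : IsSkewHilbert _≤_ _∘_ 𝟏
  𝕊-isSkewHilbert = record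
    { isPartialOrder = isPartialOrder
    ; S1 = λ _ _ → ∘-≤ , ∘≡𝟏⇒≤
    ; S2 = λ x y _ → ∘-≤ (x≤[x∘y]∘y x y)
    ; S3 = λ _ _ z x∘y≡𝟏 → ∘-≤ (∘-antitoneˡ z (∘≡𝟏⇒≤ x∘y≡𝟏))
    ; S4 = ∘-S4
    }

mainTheorem5 : (lem : ExcludedMiddle 0ℓ) →
    ((A : Set) (_≤_ : A → A → Set) (_*_ : A → A → A) (𝟏 𝟎 : A) →
      IsSkewHilbert _≤_ _*_ 𝟏 → (∀ x → 𝟎 ≤ x) →
      IsOrthoposetOn _≤_ (Image0 _*_ 𝟎) (λ x → x * 𝟎) 𝟎 𝟏
      × (((∀ x → Image0 _*_ 𝟎 x)
            × (∀ x y → Image0 _*_ 𝟎 x → Image0 _*_ 𝟎 y →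
                 Sop _≤_ lem (λ z → z * 𝟎) 𝟎 𝟏 x y ≡ x * y)
          → (∀ x → Image0 _*_ 𝟎 x)
            × (∀ x y → ¬ (x ≤ y) → y ≢ 𝟎 → x * y ≡ y))
        × ((∀ x → Image0 _*_ 𝟎 x)
            × (∀ x y → ¬ (x ≤ y) → y ≢ 𝟎 → x * y ≡ y)
          → (∀ x → Image0 _*_ 𝟎 x)
            × (∀ x y → Image0 _*_ 𝟎 x → Image0 _*_ 𝟎 y →
                 Sop _≤_ lem (λ z → z * 𝟎) 𝟎 𝟏 x y ≡ x * y))))
    ×
    ((P : Set) (_≤_ : P → P → Set) (_′ : P → P) (𝟎 𝟏 : P) →
      IsOrthoposet _≤_ _′ 𝟎 𝟏 →
      (IsSkewHilbert _≤_ (Sop _≤_ lem _′ 𝟎 𝟏) 𝟏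
        × (∀ x → 𝟎 ≤ x)
        × (∀ z → Image0 (Sop _≤_ lem _′ 𝟎 𝟏) 𝟎 z)
        × (∀ x y → ¬ (x ≤ y) → y ≢ 𝟎 → Sop _≤_ lem _′ 𝟎 𝟏 x y ≡ y)
        × IsStrong _≤_ (Sop _≤_ lem _′ 𝟎 𝟏) 𝟏)
      × ((∀ z → Image0 (Sop _≤_ lem _′ 𝟎 𝟏) 𝟎 z)
        × (∀ x → Sop _≤_ lem _′ 𝟎 𝟏 x 𝟎 ≡ x ′)))
mainTheorem5 lem =
  (λ A _≤_ _*_ 𝟏 𝟎 H 𝟎≤ →
    let open SkewHilbertProperties H
        open WithBottom 𝟎≤
    in 𝕆-isOrthoposet
     , (λ (S′-total , agrees) → S′-total , 𝕊𝕆-agrees⇒*-≰≢𝟎 lem S′-total agrees)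
     , (λ (S′-total , absorbs) → S′-total , *-≰≢𝟎⇒𝕊𝕆-agrees lem absorbs))
  ,
  (λ P _≤_ _′ 𝟎 𝟏 O →
    let open OrthoposetProperties lem O
    in (𝕊-isSkewHilbert , 𝟎≤ , ∘𝟎-surjective , (λ _ _ → ∘-≰≢𝟎) , (λ x y → ∘-≤ (x≤[x∘y]∘y x y)))
     , (∘𝟎-surjective , x∘𝟎≡x′))
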